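{- The following statements are equivalent: (i) Kurepa's hypothesis holds: for every integer $n\ge 2$, $\gcd(!n,\,n!)=2$; (ii) $S_{p-1}\not\equiv 0\pmod p$ for every prime $p\ge 3$; (iii) $S_{n-1}\not\equiv 0\pmod n$ for every integer $n\ge 3$; (iv) for every integer $n\ge 3$, the numerator of the rational number $\sum_{k=0}^{n-1}\frac{(-1)^k}{k!}$ written in lowest terms is not divisible by $n$.
   Context: The left factorial is $!0=0$ and $!n=\sum_{k=0}^{n-1}k!$ for $n\ge 1$. The derangement numbers are $S_k=k!\sum_{i=0}^{k}\frac{(-1)^i}{i!}$ for $k\ge 0$. -}

module Defs where

open import Data.Nat using (ℕ; zero; suc; _!)
open import Data.Nat.Properties using (_!≢0)
open import Data.Nat.DivMod using () renaming (_/_ to _div_)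
open import Data.List using (List; map; upTo)
open import Data.Nat.ListAction using (sum)
open import Data.Integer using (ℤ; +_; -_) renaming (_+_ to _+ℤ_; _*_ to _*ℤ_)
open import Data.Rational using (ℚ; 0ℚ) renaming (_+_ to _+ℚ_; _/_ to _/ℚ_)

-- left factorial: !n = Σ_{k=0}^{n-1} k!   (so !0 = 0)
leftFact : ℕ → ℕ
leftFact n = sum (map _! (upTo n))

sgn : ℕ → ℤ
sgn zero = + 1
sgn (suc i) = - sgn i

sumℤ : ℕ → (ℕ → ℤ) → ℤ
sumℤ zero f = + 0
sumℤ (suc m) f = sumℤ m f +ℤ f m

sumℚ : ℕ → (ℕ → ℚ) → ℚ
sumℚ zero f = 0ℚ
sumℚ (suc m) f = sumℚ m f +ℚ f m

-- derangement number S_k = k! Σ_{i=0}^{k} (-1)^i / i!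
--                        = Σ_{i=0}^{k} (-1)^i (k!/i!)   (exact division, i ≤ k)
S : ℕ → ℤ
S k = sumℤ (suc k) (λ i → sgn i *ℤ (+ (_div_ (k !) (i !) {{i !≢0}})))

altExpSum : ℕ → ℚ
altExpSum n = sumℚ n (λ k → _/ℚ_ (sgn k) (k !) {{k !≢0}})

module Submission where

-- Everything is reduced to the statement "no odd prime p divides !p" (the
-- odd-prime form).  Module LeftFactorials works in ℕ: since j! ≡ 0 (mod d) for
-- j ≥ d, the residue of !n modulo d ≤ n is that of !d; together with !2 = 2 and
-- !4 = 10 this shows that gcd(!n, n!) = 2 for all n ≥ 2 (i) iff no odd prime p
-- divides !p, iff no n ≥ 3 divides !n (an n ≥ 3 is divisible by 4 or by an odd
-- prime).  Module Derangements proves the congruence S(n-1) ≡ ±!n (mod n) by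
-- writing S k = (-1)^k R k (k) and !(k+1) = R k (-1) for one integer polynomial
-- R k, and evaluating it at the congruent points k ≡ -1 (mod k+1); this turns
-- (ii) and (iii) into the two left-factorial forms.  Module AlternatingSums shows
-- Σ_{i<n} (-1)^i / i! = S(n-1)/(n-1)!, so its reduced numerator divides S(n-1),
-- and an odd prime p dividing S(p-1) (which is coprime to (p-1)!) divides the
-- numerator; this gives (iv).

module LeftFactorials where

  open import Defs using (leftFact)
  open import Data.Nat
  open import Data.Nat.Properties
  open import Data.Nat.Divisibility
  open import Data.Nat.GCD using (gcd; gcd[m,n]∣m; gcd[m,n]∣n; gcd-greatest; gcd[m,n]≢0)
  open import Data.Nat.Primality using (Prime; euclidsLemma)
  open import Data.Nat.Primality.Factorisation using (factorise)
  open import Data.Nat.ListAction using (sum; product)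
  open import Data.Nat.ListAction.Properties using (sum-++)
  open import Data.List using ([]; _∷_; [_]; map; upTo; _++_)
  open import Data.List.Properties using (upTo-∷ʳ; map-++)
  open import Data.List.Relation.Unary.All using (_∷_)
  open import Data.Product using (∃; _×_; _,_)
  open import Data.Sum using (_⊎_; inj₁; inj₂)
  open import Data.Empty using (⊥)
  open import Function.Bundles using (_⇔_; mk⇔; Equivalence)
  open import Relation.Binary.PropositionalEquality using (_≡_; refl; sym; trans; cong; cong₂; subst; module ≡-Reasoning)
  open import Relation.Nullary using (¬_; yes; no; contradiction)
  open import Relation.Nullary.Decidable using (from-no)

  leftFact-suc : ∀ n → leftFact (suc n) ≡ leftFact n + n !
  leftFact-suc n = begin
    sum (map _! (upTo (suc n)))      ≡⟨ cong (λ l → sum (map _! l)) (sym (upTo-∷ʳ n)) ⟩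
    sum (map _! (upTo n ++ [ n ]))   ≡⟨ cong sum (map-++ _! (upTo n) [ n ]) ⟩
    sum (map _! (upTo n) ++ [ n ! ]) ≡⟨ sum-++ (map _! (upTo n)) [ n ! ] ⟩
    leftFact n + (n ! + 0)           ≡⟨ cong (leftFact n +_) (+-identityʳ (n !)) ⟩
    leftFact n + n !                 ∎
    where open ≡-Reasoning

  ∣n! : ∀ {d n} → 1 ≤ d → d ≤ n → d ∣ n !
  ∣n! {suc d} _ d<n = ∣-trans (m∣m*n (d !)) (m≤n⇒m!∣n! d<n)

  -- !(d + k) ≡ !d (mod d): every term j! with j ≥ d is a multiple of d.
  leftFact-shift : ∀ d k → 1 ≤ d → ∃ λ c → leftFact (d + k) ≡ leftFact d + c * d
  leftFact-shift d zero    _   = 0 , trans (cong leftFact (+-identityʳ d)) (sym (+-identityʳ _))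
  leftFact-shift d (suc k) 1≤d with leftFact-shift d k 1≤d | ∣n! {d} {d + k} 1≤d (m≤m+n d k)
  ... | c , eq | divides e e-eq = c + e , (begin
    leftFact (d + suc k)         ≡⟨ cong leftFact (+-suc d k) ⟩
    leftFact (suc (d + k))       ≡⟨ leftFact-suc (d + k) ⟩
    leftFact (d + k) + (d + k) ! ≡⟨ cong₂ _+_ eq e-eq ⟩
    leftFact d + c * d + e * d   ≡⟨ +-assoc (leftFact d) (c * d) (e * d) ⟩
    leftFact d + (c * d + e * d) ≡⟨ cong (leftFact d +_) (*-distribʳ-+ d c e) ⟨
    leftFact d + (c + e) * d     ∎)
    where open ≡-Reasoning

  leftFact-mod : ∀ {d n} → 1 ≤ d → d ≤ n → d ∣ leftFact n ⇔ d ∣ leftFact d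
  leftFact-mod {d} {n} 1≤d d≤n with leftFact-shift d (n ∸ d) 1≤d
  ... | c , eq = mk⇔
    (λ d∣!n → ∣m+n∣m⇒∣n (subst (d ∣_) (trans shift (+-comm (leftFact d) (c * d))) d∣!n) (n∣m*n c))
    (λ d∣!d → subst (d ∣_) (sym shift) (∣m∣n⇒∣m+n d∣!d (n∣m*n c)))
    where
    shift : leftFact n ≡ leftFact d + c * d
    shift = trans (cong leftFact (sym (m+[n∸m]≡n d≤n))) eq

  -- !n is even for n ≥ 2, since !2 = 2.
  2∣leftFact : ∀ {n} → 2 ≤ n → 2 ∣ leftFact n
  2∣leftFact 2≤n = Equivalence.from (leftFact-mod (s≤s z≤n) 2≤n) ∣-refl

  -- !n is not divisible by 4 for n ≥ 4, since !4 = 10.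
  4∤leftFact : ∀ {n} → 4 ≤ n → ¬ 4 ∣ leftFact n
  4∤leftFact 4≤n 4∣!n = from-no (4 ∣? 10) (Equivalence.to (leftFact-mod (s≤s z≤n) 4≤n) 4∣!n)

  4∣n!⇒4≤n : ∀ n → 4 ∣ n ! → 4 ≤ n
  4∣n!⇒4≤n 0 4∣n! = contradiction 4∣n! (from-no (4 ∣? 1))
  4∣n!⇒4≤n 1 4∣n! = contradiction 4∣n! (from-no (4 ∣? 1))
  4∣n!⇒4≤n 2 4∣n! = contradiction 4∣n! (from-no (4 ∣? 2))
  4∣n!⇒4≤n 3 4∣n! = contradiction 4∣n! (from-no (4 ∣? 6))
  4∣n!⇒4≤n (suc (suc (suc (suc n)))) _ = s≤s (s≤s (s≤s (s≤s z≤n)))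

  prime∣n!⇒≤ : ∀ {p} n → Prime p → p ∣ n ! → p ≤ n
  prime∣n!⇒≤ zero    pp p∣1 with ∣1⇒≡1 p∣1
  prime∣n!⇒≤ zero    () _ | refl
  prime∣n!⇒≤ (suc n) pp p∣n! with euclidsLemma (suc n) (n !) pp p∣n!
  ... | inj₁ p∣n+1 = ∣⇒≤ p∣n+1
  ... | inj₂ p∣n!  = m≤n⇒m≤1+n (prime∣n!⇒≤ n pp p∣n!)

  primeDivisor : ∀ {n} → 2 ≤ n → ∃ λ p → Prime p × p ∣ n
  primeDivisor {1} (s≤s ())
  primeDivisor {n@(suc (suc _))} _ with factorise n
  ... | record { factors = [] ; isFactorisation = () }
  ... | record { factors = p ∷ ps ; isFactorisation = n≡p*ps ; factorsPrime = pp ∷ _ } =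
    p , pp , divides (product ps) (trans n≡p*ps (*-comm p (product ps)))

  oddPrimeDivisor≥3 : ∀ {p m} → Prime p → p ∣ m → ¬ 2 ∣ m → 3 ≤ p
  oddPrimeDivisor≥3 {suc (suc (suc _))} _ _ _ = s≤s (s≤s (s≤s z≤n))
  oddPrimeDivisor≥3 {2} _ 2∣m 2∤m = contradiction 2∣m 2∤m

  odd-half≥2 : ∀ {m} → ¬ 2 ∣ m → 3 ≤ m * 2 → 2 ≤ m
  odd-half≥2 {0} 2∤0 _ = contradiction (divides 0 refl) 2∤0
  odd-half≥2 {1} _ (s≤s (s≤s ()))
  odd-half≥2 {suc (suc _)} _ _ = s≤s (s≤s z≤n)

  -- Every n ≥ 3 is divisible by 4 or by an odd prime: if n is odd take any prime
  -- divisor; if n = 2m with m even, 4 ∣ n; if n = 2m with m odd, m ≥ 2 has an odd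
  -- prime divisor.
  4-or-oddPrime-divisor : ∀ {n} → 3 ≤ n → 4 ∣ n ⊎ ∃ λ p → Prime p × 3 ≤ p × p ∣ n
  4-or-oddPrime-divisor {n} 3≤n with 2 ∣? n
  ... | no 2∤n with primeDivisor (<⇒≤ 3≤n)
  ...   | p , pp , p∣n = inj₂ (p , pp , oddPrimeDivisor≥3 pp p∣n 2∤n , p∣n)
  4-or-oddPrime-divisor {n} 3≤n | yes (divides m n≡m*2) with 2 ∣? m
  ... | yes (divides k m≡k*2) =
    inj₁ (divides k (trans n≡m*2 (trans (cong (_* 2) m≡k*2) (*-assoc k 2 2))))
  ... | no 2∤m with primeDivisor (odd-half≥2 2∤m (subst (3 ≤_) n≡m*2 3≤n))
  ...   | p , pp , p∣m =
    inj₂ (p , pp , oddPrimeDivisor≥3 pp p∣m 2∤m , ∣-trans p∣m (divides 2 (trans n≡m*2 (*-comm m 2))))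

  KurepaHypothesis : Set
  KurepaHypothesis = ∀ (n : ℕ) → n ≥ 2 → gcd (leftFact n) (n !) ≡ 2

  OddPrimeForm : Set
  OddPrimeForm = ∀ p → Prime p → p ≥ 3 → ¬ p ∣ leftFact p

  GeneralForm : Set
  GeneralForm = ∀ n → n ≥ 3 → ¬ n ∣ leftFact n

  -- Under the odd-prime form, !n and n! have no common divisor d ≥ 3: either 4 ∣ d,
  -- impossible since 4 ∣ n! forces n ≥ 4 and then 4 ∤ !n; or some odd prime p ∣ d,
  -- and p ∣ n! gives p ≤ n, so p ∣ !n reduces to the excluded p ∣ !p.
  no-common-divisor≥3 : OddPrimeForm → ∀ n {d} → 3 ≤ d → d ∣ leftFact n → d ∣ n ! → ⊥
  no-common-divisor≥3 oddPrimes n 3≤d d∣!n d∣n! with 4-or-oddPrime-divisor 3≤d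
  ... | inj₁ 4∣d = 4∤leftFact (4∣n!⇒4≤n n (∣-trans 4∣d d∣n!)) (∣-trans 4∣d d∣!n)
  ... | inj₂ (p , pp , 3≤p , p∣d) =
    oddPrimes p pp 3≤p (Equivalence.to (leftFact-mod 1≤p p≤n) (∣-trans p∣d d∣!n))
    where
    1≤p : 1 ≤ p
    1≤p = m<n⇒0<n 3≤p
    p≤n : p ≤ n
    p≤n = prime∣n!⇒≤ n pp (∣-trans p∣d d∣n!)

  -- (i) ⇒ odd-prime form: an odd prime p dividing !p would divide gcd(!p, p!) = 2.
  kurepa⇒oddPrimeForm : KurepaHypothesis → OddPrimeForm
  kurepa⇒oddPrimeForm kurepa p pp 3≤p p∣!p = <⇒≱ 3≤p (∣⇒≤ p∣2)
    where
    p∣2 : p ∣ 2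
    p∣2 = subst (p ∣_) (kurepa p (<⇒≤ 3≤p))
            (gcd-greatest p∣!p (∣n! (m<n⇒0<n 3≤p) ≤-refl))

  -- Odd-prime form ⇒ (i): the gcd is even and nonzero, hence 2 or at least 3,
  -- and the latter is excluded by no-common-divisor≥3.
  oddPrimeForm⇒kurepa : OddPrimeForm → KurepaHypothesis
  oddPrimeForm⇒kurepa oddPrimes n 2≤n with gcd (leftFact n) (n !) ≟ 2
  ... | yes g≡2 = g≡2
  ... | no  g≢2 = contradiction (gcd[m,n]∣n (leftFact n) (n !))
                    (no-common-divisor≥3 oddPrimes n 3≤g (gcd[m,n]∣m (leftFact n) (n !)))
    where
    g : ℕ
    g = gcd (leftFact n) (n !)
    instance
      g≢0 : NonZero g
      g≢0 = ≢-nonZero (gcd[m,n]≢0 (leftFact n) (n !) (inj₂ (≢-nonZero⁻¹ (n !) {{n !≢0}})))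
    2≤g : 2 ≤ g
    2≤g = ∣⇒≤ (gcd-greatest (2∣leftFact 2≤n) (∣n! (s≤s z≤n) 2≤n))
    3≤g : 3 ≤ g
    3≤g = ≤∧≢⇒< 2≤g (λ 2≡g → g≢2 (sym 2≡g))

  kurepa⇔oddPrimeForm : KurepaHypothesis ⇔ OddPrimeForm
  kurepa⇔oddPrimeForm = mk⇔ kurepa⇒oddPrimeForm oddPrimeForm⇒kurepa

  -- Odd-prime form ⇒ general form, since n ≥ 3 with n ∣ !n would be a common
  -- divisor of !n and n!; the converse is a specialisation.
  oddPrimeForm⇔generalForm : OddPrimeForm ⇔ GeneralForm
  oddPrimeForm⇔generalForm = mk⇔
    (λ oddPrimes n 3≤n n∣!n → no-common-divisor≥3 oddPrimes n 3≤n n∣!n (∣n! (m<n⇒0<n 3≤n) ≤-refl))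
    (λ general p _ → general p)

module Derangements where

  open import Defs using (leftFact; sgn; sumℤ; S)
  open LeftFactorials using (leftFact-suc; OddPrimeForm; GeneralForm)
  open import Data.Nat as ℕ using (ℕ; zero; suc; _!; s≤s)
  import Data.Nat.Properties as ℕ
  open import Data.Nat.Properties using (_!≢0)
  import Data.Nat.Divisibility as ℕ
  open import Data.Nat.DivMod using (*-/-assoc; n/n≡1) renaming (_/_ to _div_)
  open import Data.Integer using (ℤ; +_; -[1+_]; -_; _+_; _-_; _*_; ∣_∣)
  open import Data.Integer.Properties using (*-zeroʳ; *-distribˡ-+; pos-*; pos-+; *-identityʳ; abs-*; ∣-i∣≡∣i∣)
  open import Data.Integer.Divisibility using (_∣_)
  open import Data.Integer.Divisibility.Signed as Signed using () renaming (_∣_ to _∣ˢ_)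
  open import Data.Integer.Solver using (module +-*-Solver)
  open +-*-Solver using (solve; _:+_; _:-_; _:*_; :-_; _:=_; con)
  open import Data.Nat.Primality using (Prime)
  open import Relation.Nullary using (¬_)
  open import Function.Bundles using (_⇔_; mk⇔; Equivalence)
  open import Relation.Binary.PropositionalEquality using (_≡_; refl; sym; trans; cong; cong₂; subst; module ≡-Reasoning)

  sumℤ-scale : ∀ m (f g : ℕ → ℤ) c → (∀ i → i ℕ.< m → f i ≡ c * g i) → sumℤ m f ≡ c * sumℤ m g
  sumℤ-scale zero    f g c _  = sym (*-zeroʳ c)
  sumℤ-scale (suc m) f g c eq = trans
    (cong₂ _+_ (sumℤ-scale m f g c (λ i i<m → eq i (ℕ.m≤n⇒m≤1+n i<m))) (eq m ℕ.≤-refl))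
    (sym (*-distribˡ-+ c (sumℤ m g) (g m)))

  -- The derangement recursion S (k+1) = (k+1) S k + (-1)^(k+1): every term but the
  -- last one of S (k+1) is (k+1) times the corresponding term of S k.
  S-suc : ∀ k → S (suc k) ≡ + suc k * S k + sgn (suc k)
  S-suc k = cong₂ _+_ (sumℤ-scale (suc k) term₊ term (+ suc k) scaled) last
    where
    term₊ term : ℕ → ℤ
    term₊ i = sgn i * + (_div_ (suc k !) (i !) {{i !≢0}})
    term  i = sgn i * + (_div_ (k !) (i !) {{i !≢0}})
    scaled : ∀ i → i ℕ.< suc k → term₊ i ≡ + suc k * term i
    scaled i (s≤s i≤k) = begin
      sgn i * + (_div_ (suc k ℕ.* k !) (i !) {{i !≢0}})
        ≡⟨ cong (λ x → sgn i * + x) (*-/-assoc (suc k) {{i !≢0}} (ℕ.m≤n⇒m!∣n! i≤k)) ⟩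
      sgn i * + (suc k ℕ.* _div_ (k !) (i !) {{i !≢0}})
        ≡⟨ cong (sgn i *_) (pos-* (suc k) _) ⟩
      sgn i * (+ suc k * + (_div_ (k !) (i !) {{i !≢0}}))
        ≡⟨ solve 3 (λ a b c → a :* (b :* c) := b :* (a :* c)) refl (sgn i) (+ suc k) _ ⟩
      + suc k * term i ∎
      where open ≡-Reasoning
    last : term₊ (suc k) ≡ sgn (suc k)
    last = trans (cong (λ x → sgn (suc k) * + x) (n/n≡1 (suc k !) {{suc k !≢0}})) (*-identityʳ _)

  -- The polynomials R j x = Σ_{i ≤ j} (-1)^i x (x - 1) ⋯ (x - i + 1), given by
  -- their Horner-like recursion.  They are integer polynomials, so they respect
  -- congruences, and they interpolate both S (at x = k) and !n (at x = -1).
  R : ℕ → ℤ → ℤ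
  R zero    x = + 1
  R (suc j) x = + 1 - x * R j (x - + 1)

  S≡±R : ∀ k → S k ≡ sgn k * R k (+ k)
  S≡±R zero    = refl
  S≡±R (suc k) = begin
    S (suc k)                                ≡⟨ S-suc k ⟩
    + suc k * S k + sgn (suc k)              ≡⟨ cong (λ s → + suc k * s + sgn (suc k)) (S≡±R k) ⟩
    + suc k * (sgn k * R k (+ k)) - sgn k    ≡⟨ solve 3 (λ a s r → a :* (s :* r) :- s := (:- s) :* (con (+ 1) :- a :* r))
                                                  refl (+ suc k) (sgn k) (R k (+ k)) ⟩
    - sgn k * (+ 1 - + suc k * R k (+ k))    ∎
    where open ≡-Reasoning

  R-cong : ∀ j {n x y} → n ∣ˢ x - y → n ∣ˢ R j x - R j y
  R-cong zero    {n} _ = Signed.divides (+ 0) refl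
  R-cong (suc j) {n} {x} {y} n∣x-y = subst (n ∣ˢ_) expand
    (Signed.∣m⇒∣-m (Signed.∣m∣n⇒∣m+n (Signed.∣m⇒∣m*n (R j (x - + 1)) n∣x-y)
                                     (Signed.∣n⇒∣m*n y (R-cong j n∣shifted))))
    where
    n∣shifted : n ∣ˢ (x - + 1) - (y - + 1)
    n∣shifted = subst (n ∣ˢ_) (solve 2 (λ x y → x :- y := (x :- con (+ 1)) :- (y :- con (+ 1))) refl x y) n∣x-y
    expand : - ((x - y) * R j (x - + 1) + y * (R j (x - + 1) - R j (y - + 1))) ≡ R (suc j) x - R (suc j) y
    expand = solve 4 (λ x y a b → :- ((x :- y) :* a :+ y :* (a :- b))
                                    := (con (+ 1) :- x :* a) :- (con (+ 1) :- y :* b))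
               refl x y (R j (x - + 1)) (R j (y - + 1))

  R-at-negative : ∀ j b → + (b !) * R j -[1+ b ] + + leftFact b ≡ + leftFact (suc b ℕ.+ j)
  R-at-negative zero b = begin
    + (b !) * + 1 + + leftFact b ≡⟨ cong (_+ + leftFact b) (*-identityʳ (+ (b !))) ⟩
    + (b !) + + leftFact b       ≡⟨ pos-+ (b !) (leftFact b) ⟨
    + (b ! ℕ.+ leftFact b)       ≡⟨ cong +_ (ℕ.+-comm (b !) (leftFact b)) ⟩
    + (leftFact b ℕ.+ b !)       ≡⟨ cong +_ (leftFact-suc b) ⟨
    + leftFact (suc b)           ≡⟨ cong (λ m → + leftFact (suc m)) (ℕ.+-identityʳ b) ⟨
    + leftFact (suc b ℕ.+ 0)     ∎
    where open ≡-Reasoning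
  R-at-negative (suc j) b = begin
    + (b !) * (+ 1 - -[1+ b ] * R j (-[1+ b ] - + 1)) + + leftFact b
      ≡⟨ cong (λ m → + (b !) * (+ 1 - -[1+ b ] * R j -[1+ suc m ]) + + leftFact b) (ℕ.+-identityʳ b) ⟩
    + (b !) * (+ 1 - (- + suc b) * Rj) + + leftFact b
      ≡⟨ solve 4 (λ f c r l → f :* (con (+ 1) :- (:- c) :* r) :+ l := (c :* f) :* r :+ (l :+ f))
                 refl (+ (b !)) (+ suc b) Rj (+ leftFact b) ⟩
    (+ suc b * + (b !)) * Rj + (+ leftFact b + + (b !))
      ≡⟨ cong₂ (λ f l → f * Rj + l) (sym (pos-* (suc b) (b !))) (sym (pos-+ (leftFact b) (b !))) ⟩
    + (suc b !) * Rj + + (leftFact b ℕ.+ b !)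
      ≡⟨ cong (λ l → + (suc b !) * Rj + + l) (sym (leftFact-suc b)) ⟩
    + (suc b !) * Rj + + leftFact (suc b)
      ≡⟨ R-at-negative j (suc b) ⟩
    + leftFact (suc (suc b) ℕ.+ j)
      ≡⟨ cong (λ m → + leftFact (suc m)) (ℕ.+-suc b j) ⟨
    + leftFact (suc b ℕ.+ suc j) ∎
    where
    open ≡-Reasoning
    Rj : ℤ
    Rj = R j -[1+ suc b ]

  R-at-minus-one : ∀ j → R j -[1+ 0 ] ≡ + leftFact (suc j)
  R-at-minus-one j = begin
    R j -[1+ 0 ]               ≡⟨ solve 1 (λ r → r := con (+ 1) :* r :+ con (+ 0)) refl (R j -[1+ 0 ]) ⟩
    + 1 * R j -[1+ 0 ] + + 0   ≡⟨ R-at-negative j 0 ⟩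
    + leftFact (suc j)         ∎
    where open ≡-Reasoning

  -- Main congruence: S m ≡ (-1)^m !(m+1) (mod m+1), because m ≡ -1 (mod m+1)
  -- and S m = (-1)^m R m m while !(m+1) = R m (-1).
  S-congruence : ∀ m → + suc m ∣ˢ S m - sgn m * + leftFact (suc m)
  S-congruence m = subst (+ suc m ∣ˢ_) factor
    (Signed.∣n⇒∣m*n (sgn m) (R-cong m (Signed.∣-reflexive (cong +_ (ℕ.+-comm 1 m)))))
    where
    factor : sgn m * (R m (+ m) - R m -[1+ 0 ]) ≡ S m - sgn m * + leftFact (suc m)
    factor = begin
      sgn m * (R m (+ m) - R m -[1+ 0 ])
        ≡⟨ solve 3 (λ s a b → s :* (a :- b) := s :* a :- s :* b) refl (sgn m) (R m (+ m)) (R m -[1+ 0 ]) ⟩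
      sgn m * R m (+ m) - sgn m * R m -[1+ 0 ]
        ≡⟨ cong₂ (λ a b → a - sgn m * b) (sym (S≡±R m)) (R-at-minus-one m) ⟩
      S m - sgn m * + leftFact (suc m)
        ∎
      where open ≡-Reasoning

  ∣ˢ-congruent : ∀ {k a b} → k ∣ˢ a - b → k ∣ˢ a ⇔ k ∣ˢ b
  ∣ˢ-congruent {k} {a} {b} k∣a-b = mk⇔
    (λ k∣a → subst (k ∣ˢ_) (solve 2 (λ a b → a :- (a :- b) := b) refl a b) (Signed.∣m∣n⇒∣m-n k∣a k∣a-b))
    (λ k∣b → subst (k ∣ˢ_) (solve 2 (λ a b → (a :- b) :+ b := a) refl a b) (Signed.∣m∣n⇒∣m+n k∣a-b k∣b))

  ∣sgn*x∣ : ∀ m x → ∣ sgn m * x ∣ ≡ ∣ x ∣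
  ∣sgn*x∣ m x = trans (abs-* (sgn m) x) (trans (cong (ℕ._* ∣ x ∣) (∣sgn∣ m)) (ℕ.*-identityˡ ∣ x ∣))
    where
    ∣sgn∣ : ∀ m → ∣ sgn m ∣ ≡ 1
    ∣sgn∣ zero    = refl
    ∣sgn∣ (suc m) = trans (∣-i∣≡∣i∣ (sgn m)) (∣sgn∣ m)

  S-divisibility : ∀ m → + suc m ∣ S m ⇔ suc m ℕ.∣ leftFact (suc m)
  S-divisibility m = mk⇔
    (λ n∣S → subst (suc m ℕ.∣_) (∣sgn*x∣ m L)
               (Signed.∣⇒∣ᵤ (Equivalence.to congruent (Signed.∣ᵤ⇒∣ n∣S))))
    (λ n∣L → Signed.∣⇒∣ᵤ (Equivalence.from congruent
               (Signed.∣ᵤ⇒∣ (subst (suc m ℕ.∣_) (sym (∣sgn*x∣ m L)) n∣L))))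
    where
    L : ℤ
    L = + leftFact (suc m)
    congruent : + suc m ∣ˢ S m ⇔ + suc m ∣ˢ sgn m * L
    congruent = ∣ˢ-congruent (S-congruence m)

  S-divisibility′ : ∀ n → 1 ℕ.≤ n → + n ∣ S (n ℕ.∸ 1) ⇔ n ℕ.∣ leftFact n
  S-divisibility′ (suc m) _ = S-divisibility m

  DerangementPrimeForm : Set
  DerangementPrimeForm = ∀ (p : ℕ) → Prime p → p ℕ.≥ 3 → ¬ ((+ p) ∣ S (p ℕ.∸ 1))

  DerangementForm : Set
  DerangementForm = ∀ (n : ℕ) → n ℕ.≥ 3 → ¬ ((+ n) ∣ S (n ℕ.∸ 1))

  oddPrimeForm⇔derangementPrimeForm : OddPrimeForm ⇔ DerangementPrimeForm
  oddPrimeForm⇔derangementPrimeForm = mk⇔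
    (λ oddPrimes p pp 3≤p p∣S →
       oddPrimes p pp 3≤p (Equivalence.to (S-divisibility′ p (ℕ.m<n⇒0<n 3≤p)) p∣S))
    (λ oddPrimes p pp 3≤p p∣!p →
       oddPrimes p pp 3≤p (Equivalence.from (S-divisibility′ p (ℕ.m<n⇒0<n 3≤p)) p∣!p))

  generalForm⇔derangementForm : GeneralForm ⇔ DerangementForm
  generalForm⇔derangementForm = mk⇔
    (λ general n 3≤n n∣S →
       general n 3≤n (Equivalence.to (S-divisibility′ n (ℕ.m<n⇒0<n 3≤n)) n∣S))
    (λ general n 3≤n n∣!n →
       general n 3≤n (Equivalence.from (S-divisibility′ n (ℕ.m<n⇒0<n 3≤n)) n∣!n))

module AlternatingSums where

  open import Defs using (sgn; S; altExpSum)
  open LeftFactorials using (prime∣n!⇒≤; OddPrimeForm; oddPrimeForm⇔generalForm)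
  open Derangements using (S-suc; S-divisibility)
  open import Data.Nat as ℕ using (ℕ; zero; suc; _!)
  open import Data.Nat.Properties using (_!≢0)
  open import Data.Integer as ℤ using (+_; ∣_∣)
  open import Data.Integer.Properties using (pos-*; abs-*)
  open import Data.Nat.Divisibility using (_∣_; divides; ∣-trans; m∣m*n)
  import Data.Nat.Properties as ℕ
  open import Data.Nat.Coprimality using (coprime-divisor; recompute)
  open import Data.Nat.Primality using (Prime; euclidsLemma)
  open import Data.Sum using (inj₁; inj₂)
  open import Relation.Nullary using (¬_; contradiction)
  open import Data.Rational using (mkℚ; ↥_; ↧_; ↧ₙ_; toℚᵘ) renaming (_/_ to _/ℚ_; _+_ to _+ℚ_)
  import Data.Rational.Properties as ℚ
  open import Data.Rational.Unnormalised using (mkℚᵘ; _≃_; *≡*) renaming (_/_ to _/ᵘ_; _+_ to _+ᵘ_)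
  import Data.Rational.Unnormalised.Properties as ℚᵘ
  open import Data.Integer.Solver using (module +-*-Solver)
  open +-*-Solver using (solve; _:+_; _:*_; _:=_)
  open import Data.Integer.Divisibility using () renaming (_∣_ to _ℤ∣_)
  open import Function.Bundles using (_⇔_; mk⇔; Equivalence)
  open import Relation.Binary.PropositionalEquality using (_≡_; refl; sym; trans; cong; subst; module ≡-Reasoning)

  toℚᵘ-/ : ∀ i n .{{_ : ℕ.NonZero n}} → toℚᵘ (i /ℚ n) ≃ i /ᵘ n
  toℚᵘ-/ i (suc n) = ℚ.toℚᵘ-fromℚᵘ (mkℚᵘ i n)

  +-common-denominator : ∀ a c b m .{{_ : ℕ.NonZero b}} .{{_ : ℕ.NonZero (suc m ℕ.* b)}} →
                         a /ᵘ b +ᵘ c /ᵘ (suc m ℕ.* b) ≃ (+ suc m ℤ.* a ℤ.+ c) /ᵘ (suc m ℕ.* b)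
  +-common-denominator a c b@(suc _) m = *≡* (begin
    (a ℤ.* + (M ℕ.* b) ℤ.+ c ℤ.* + b) ℤ.* + (M ℕ.* b)
      ≡⟨ cong (λ x → (a ℤ.* x ℤ.+ c ℤ.* + b) ℤ.* x) (pos-* M b) ⟩
    (a ℤ.* (+ M ℤ.* + b) ℤ.+ c ℤ.* + b) ℤ.* (+ M ℤ.* + b)
      ≡⟨ solve 4 (λ a c m b → (a :* (m :* b) :+ c :* b) :* (m :* b) := (m :* a :+ c) :* (b :* (m :* b)))
                 refl a c (+ M) (+ b) ⟩
    (+ M ℤ.* a ℤ.+ c) ℤ.* (+ b ℤ.* (+ M ℤ.* + b))
      ≡⟨ cong (λ x → (+ M ℤ.* a ℤ.+ c) ℤ.* (+ b ℤ.* x)) (sym (pos-* M b)) ⟩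
    (+ M ℤ.* a ℤ.+ c) ℤ.* (+ b ℤ.* + (M ℕ.* b))
      ≡⟨ cong ((+ M ℤ.* a ℤ.+ c) ℤ.*_) (sym (pos-* b (M ℕ.* b))) ⟩
    (+ M ℤ.* a ℤ.+ c) ℤ.* + (b ℕ.* (M ℕ.* b)) ∎)
    where
    open ≡-Reasoning
    M : ℕ
    M = suc m

  altExpSum≃S/k! : ∀ k → toℚᵘ (altExpSum (suc k)) ≃ (S k /ᵘ (k !)) {{k !≢0}}
  altExpSum≃S/k! zero    = *≡* refl
  altExpSum≃S/k! (suc k) = begin
    toℚᵘ (altExpSum (suc k) +ℚ (sgn (suc k) /ℚ (suc k !)) {{suc k !≢0}})
      ≈⟨ ℚ.toℚᵘ-homo-+ (altExpSum (suc k)) _ ⟩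
    toℚᵘ (altExpSum (suc k)) +ᵘ toℚᵘ ((sgn (suc k) /ℚ (suc k !)) {{suc k !≢0}})
      ≈⟨ ℚᵘ.+-cong (altExpSum≃S/k! k) (toℚᵘ-/ (sgn (suc k)) (suc k !) {{suc k !≢0}}) ⟩
    (S k /ᵘ (k !)) {{k !≢0}} +ᵘ (sgn (suc k) /ᵘ (suc k !)) {{suc k !≢0}}
      ≈⟨ +-common-denominator (S k) (sgn (suc k)) (k !) k {{k !≢0}} {{suc k !≢0}} ⟩
    ((+ suc k ℤ.* S k ℤ.+ sgn (suc k)) /ᵘ (suc k !)) {{suc k !≢0}}
      ≡⟨ cong (λ x → (x /ᵘ (suc k !)) {{suc k !≢0}}) (S-suc k) ⟨
    (S (suc k) /ᵘ (suc k !)) {{suc k !≢0}} ∎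
    where open ℚᵘ.≃-Reasoning

  cross-multiply : ∀ q a b .{{_ : ℕ.NonZero b}} → toℚᵘ q ≃ a /ᵘ b → ∣ ↥ q ∣ ℕ.* b ≡ ∣ a ∣ ℕ.* ↧ₙ q
  cross-multiply q@(mkℚ _ _ _) a (suc b) (*≡* eq) =
    trans (sym (abs-* (↥ q) (+ suc b))) (trans (cong ∣_∣ eq) (abs-* a (↧ q)))

  -- The reduced numerator of a / b divides a, since it is coprime to the denominator.
  numerator∣ : ∀ q a b .{{_ : ℕ.NonZero b}} → toℚᵘ q ≃ a /ᵘ b → ∣ ↥ q ∣ ∣ ∣ a ∣
  numerator∣ q@(mkℚ n d coprime) a b q≃a/b = coprime-divisor (recompute coprime)
    (divides b (trans (ℕ.*-comm (↧ₙ q) ∣ a ∣) (trans (sym (cross-multiply q a b q≃a/b)) (ℕ.*-comm ∣ n ∣ b))))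

  prime∣numerator : ∀ q a b {p} .{{_ : ℕ.NonZero b}} → toℚᵘ q ≃ a /ᵘ b →
                    Prime p → p ∣ ∣ a ∣ → ¬ p ∣ b → p ∣ ∣ ↥ q ∣
  prime∣numerator q a b {p} q≃a/b pp p∣a p∤b
    with euclidsLemma ∣ ↥ q ∣ b pp
           (subst (p ∣_) (sym (cross-multiply q a b q≃a/b)) (∣-trans p∣a (m∣m*n (↧ₙ q))))
  ... | inj₁ p∣num = p∣num
  ... | inj₂ p∣b   = contradiction p∣b p∤b

  numerator∣S : ∀ m → ∣ ↥ altExpSum (suc m) ∣ ∣ ∣ S m ∣
  numerator∣S m = numerator∣ _ (S m) (m !) {{m !≢0}} (altExpSum≃S/k! m)

  -- A prime p = m + 1 dividing S m divides that numerator too, as p ∤ m!.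
  prime∣S⇒prime∣numerator : ∀ m → Prime (suc m) → suc m ∣ ∣ S m ∣ → suc m ∣ ∣ ↥ altExpSum (suc m) ∣
  prime∣S⇒prime∣numerator m pp p∣S = prime∣numerator _ (S m) (m !) {{m !≢0}} (altExpSum≃S/k! m) pp p∣S
    (λ p∣m! → ℕ.<⇒≱ ℕ.≤-refl (prime∣n!⇒≤ m pp p∣m!))

  NumeratorForm : Set
  NumeratorForm = ∀ (n : ℕ) → n ℕ.≥ 3 → ¬ ((+ n) ℤ∣ (↥ altExpSum n))

  -- (iv) is equivalent to the odd-prime form: a divisor n ≥ 3 of the numerator
  -- divides S (n-1), hence !n, contradicting the general form; conversely an odd
  -- prime p dividing !p divides S (p-1), hence the numerator.

  oddPrimeForm⇔numeratorForm : OddPrimeForm ⇔ NumeratorForm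
  oddPrimeForm⇔numeratorForm = mk⇔
    (λ oddPrimes → λ { (suc m) 3≤n n∣num →
       Equivalence.to oddPrimeForm⇔generalForm oddPrimes (suc m) 3≤n
         (Equivalence.to (S-divisibility m) (∣-trans n∣num (numerator∣S m))) })
    (λ numerators → λ { (suc m) pp 3≤p p∣!p →
       numerators (suc m) 3≤p (prime∣S⇒prime∣numerator m pp (Equivalence.from (S-divisibility m) p∣!p)) })

open import Defs
open import Data.Nat using (ℕ; _≥_; _∸_)
open import Data.Nat.GCD using (gcd)
open import Data.Nat.Primality using (Prime)
open import Data.Nat using (_!)
open import Data.Integer using (+_)
open import Data.Integer.Divisibility using (_∣_)
open import Data.Rational using (↥_)
open import Data.Product using (_×_; _,_)
open import Function.Bundles using (_⇔_)
open import Function.Construct.Composition using (_⇔-∘_)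
open import Relation.Binary.PropositionalEquality using (_≡_)
open import Relation.Nullary using (¬_)
open LeftFactorials using (kurepa⇔oddPrimeForm; oddPrimeForm⇔generalForm)
open Derangements using (oddPrimeForm⇔derangementPrimeForm; generalForm⇔derangementForm)
open AlternatingSums using (oddPrimeForm⇔numeratorForm)

theorem4 : ((∀ (n : ℕ) → n ≥ 2 → gcd (leftFact n) (n !) ≡ 2)
    ⇔ (∀ (p : ℕ) → Prime p → p ≥ 3 → ¬ ((+ p) ∣ S (p ∸ 1))))
    × ((∀ (n : ℕ) → n ≥ 2 → gcd (leftFact n) (n !) ≡ 2)
    ⇔ (∀ (n : ℕ) → n ≥ 3 → ¬ ((+ n) ∣ S (n ∸ 1))))
    × ((∀ (n : ℕ) → n ≥ 2 → gcd (leftFact n) (n !) ≡ 2)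
    ⇔ (∀ (n : ℕ) → n ≥ 3 → ¬ ((+ n) ∣ (↥ altExpSum n))))
theorem4 = oddPrimeForm⇔derangementPrimeForm ⇔-∘ kurepa⇔oddPrimeForm
         , generalForm⇔derangementForm ⇔-∘ (oddPrimeForm⇔generalForm ⇔-∘ kurepa⇔oddPrimeForm)
         , oddPrimeForm⇔numeratorForm ⇔-∘ kurepa⇔oddPrimeForm
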